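{- Let $t\colon\mathbb{N}\to\mathbb{N}$. Any $(t(n),1/3)$-LCA for Knapsack which provides query access to an optimal solution must satisfy $t(n)=\Omega(n)$.
   Context: Knapsack: an instance $I$ consists of a weight limit $K\ge 0$ and $n$ items $a_i=(p_i,w_i)$, $i\in[n]$, with profit $p_i\ge 0$ and weight $w_i\ge 0$; the total profit of all items is normalized to $1$ and every item has weight at most $K$. A set $C\subseteq[n]$ is feasible if $\sum_{i\in C}w_i\le K$; its value is $\sum_{i\in C}p_i$; an optimal solution is a feasible set of maximum value. A $(t(n),\delta(n))$-LCA (local computation algorithm) for Knapsack is a randomized algorithm that is given a read-only random seed $r$ and query access to the instance (querying index $j$ returns $(p_j,w_j)$). On input a query $i\in[n]$ it makes queries to the instance, runs in time at most $t(n)$ (so in particular makes at most $t(n)$ queries to the instance), and outputs whether item $i$ belongs to a feasible solution $C$; it must be correct with probability at least $1-\delta(n)$. The solution $C$ depends only on $I$ and $r$; the algorithm keeps no state between queries, so independent runs with the same $I$ and $r$ answer consistently with the same $C$ regardless of the order of queries. "Provides query access to an optimal solution" means that $C$ is required to be an optimal solution. -}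

module Defs where

open import Data.Nat using (ℕ; zero; suc; _≤_; _*_)
open import Data.Fin using (Fin; zero; suc)
open import Data.Bool using (Bool; true; false; if_then_else_)
import Data.Bool as B
open import Data.Rational using (ℚ; 0ℚ; 1ℚ; _+_) renaming (_≤_ to _≤ℚ_)
open import Relation.Binary.PropositionalEquality using (_≡_)
open import Relation.Nullary.Decidable using (⌊_⌋)

Σ : (n : ℕ) → (Fin n → ℚ) → ℚ
Σ zero    f = 0ℚ
Σ (suc n) f = f zero + Σ n (λ i → f (suc i))

count : (m : ℕ) → (Fin m → Bool) → ℕ
count zero    P = 0
count (suc m) P = (if P zero then 1 else 0) Data.Nat.+ count m (λ i → P (suc i))

record Instance (n : ℕ) : Set where
  field
    K       : ℚ
    profit  : Fin n → ℚ
    weight  : Fin n → ℚ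
    K≥0     : 0ℚ ≤ℚ K
    profit≥0 : ∀ i → 0ℚ ≤ℚ profit i
    weight≥0 : ∀ i → 0ℚ ≤ℚ weight i
    weight≤K : ∀ i → weight i ≤ℚ K
    total   : Σ n profit ≡ 1ℚ
open Instance public

Subset : ℕ → Set
Subset n = Fin n → Bool

sumOn : ∀ {n} → Subset n → (Fin n → ℚ) → ℚ
sumOn {n} C f = Σ n (λ i → if C i then f i else 0ℚ)

Feasible : ∀ {n} → Instance n → Subset n → Set
Feasible I C = sumOn C (weight I) ≤ℚ K I

value : ∀ {n} → Instance n → Subset n → ℚ
value I C = sumOn C (profit I)

Optimal : ∀ {n} → Instance n → Subset n → Set
Optimal I C = Feasible I C × (∀ D → Feasible I D → value I D ≤ℚ value I C)
  where open import Data.Product using (_×_)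

-- Deterministic adaptive query procedures (decision trees) on n items.
-- Querying index j returns (p_j , w_j).

data Tree (n : ℕ) : Set where
  leaf  : Bool → Tree n
  query : Fin n → (ℚ → ℚ → Tree n) → Tree n

run : ∀ {n} → Tree n → Instance n → Bool
run (leaf b)    I = b
run (query j k) I = run (k (profit I j) (weight I j)) I

cost : ∀ {n} → Tree n → Instance n → ℕ
cost (leaf b)    I = 0
cost (query j k) I = suc (cost (k (profit I j) (weight I j)) I)

-- For each n the random seed r is uniform on Fin (seeds n);
-- on query i, with seed r and weight limit K, the algorithm is the
-- deterministic query procedure  alg n r K i.  sol n I r is the solution
-- C (depending only on I and r), required to be optimal.

record OptimalLCA (t : ℕ → ℕ) : Set where
  field
    seeds    : ℕ → ℕ
    seeds≥1  : ∀ n → 1 ≤ seeds n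
    alg      : ∀ n → Fin (seeds n) → ℚ → Fin n → Tree n
    sol      : ∀ n → Instance n → Fin (seeds n) → Subset n
    time     : ∀ n (I : Instance n) r i → cost (alg n r (K I) i) I ≤ t n
    optimal  : ∀ n (I : Instance n) r → Optimal I (sol n I r)
    -- correct with probability ≥ 1 - 1/3 = 2/3 over the seed
    correct  : ∀ n (I : Instance n) (i : Fin n) →
               2 * seeds n ≤ 3 * count (seeds n)
                 (λ r → ⌊ run (alg n r (K I) i) I B.≟ sol n I r i ⌋)

-- An instance with capacity 1 has item 0 of weight 1 and profit 3⁻ᵐ and items 1, …, m of
-- weight 0 and larger profits, so every optimum contains item 0.  Raising the weight of item
-- j+1 to 1 makes every optimum contain item j+1 and hence drop item 0.  On query 0 an LCA must
-- therefore say yes on the first instance and no on the j-th modified one, each with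
-- probability 2/3; the two runs can only differ if item j+1 is queried, so on the first
-- instance item j+1 is queried with probability at least 1/3.  Counting the pairs
-- (seed, queried item) both ways gives m/3 ≤ t(m+1).

module Submission where

open import Defs
open import Data.Nat as ℕ using (ℕ; zero; suc; z≤n; s≤s; NonZero; _+_; _≤_; _*_)
open import Data.Product using (Σ-syntax; _×_; _,_)

import Data.Nat.Properties as ℕ
open import Algebra.Properties.Semiring.Sum ℕ.+-*-semiring
  using (sum-syntax; sum-cong-≗; ∑-comm; ∑-distrib-+; *-distribˡ-sum)
open import Data.Bool as Bool using (Bool; true; false; if_then_else_; _∧_; _∨_)
open import Data.Empty using (⊥-elim)
open import Data.Fin using (Fin; zero; suc; _≟_)
import Data.Integer as ℤ
open import Data.List using (List; []; _∷_; length)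
open import Data.List.Membership.Propositional using (_∈_)
import Data.List.Membership.DecPropositional
open import Data.List.Relation.Unary.Any using (here; there)
open import Data.Nat.Tactic.RingSolver using (solve-∀)
open import Data.Rational as ℚ using (ℚ; 0ℚ; 1ℚ; _/_)
  renaming (_+_ to _+ℚ_; _*_ to _*ℚ_; _≤_ to _≤ℚ_; _<_ to _<ℚ_)
import Data.Rational.Properties as ℚ
open import Data.Rational.Solver using (module +-*-Solver)
open import Function using (_∘_)
open import Relation.Binary.PropositionalEquality
open import Relation.Nullary using (does; yes; no; contradiction)
open import Relation.Nullary.Decidable using (⌊_⌋; dec-true; dec-false; toWitness)

open module Fin∈ {n} = Data.List.Membership.DecPropositional (_≟_ {n}) using (_∈?_)

𝟙 : Bool → ℕ
𝟙 b = if b then 1 else 0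

∑-mono-≤ : ∀ {n} {f g : Fin n → ℕ} → (∀ i → f i ≤ g i) → ∑[ i < n ] f i ≤ ∑[ i < n ] g i
∑-mono-≤ {zero}  _   = z≤n
∑-mono-≤ {suc n} f≤g = ℕ.+-mono-≤ (f≤g zero) (∑-mono-≤ (f≤g ∘ suc))

∑-const : ∀ n c → ∑[ i < n ] c ≡ n * c
∑-const zero    c = refl
∑-const (suc n) c = cong (c +_) (∑-const n c)

count≡∑𝟙 : ∀ m (P : Fin m → Bool) → count m P ≡ ∑[ i < m ] 𝟙 (P i)
count≡∑𝟙 zero    P = refl
count≡∑𝟙 (suc m) P = cong (𝟙 (P zero) +_) (count≡∑𝟙 m (P ∘ suc))

count-false : ∀ m → count m (λ _ → false) ≡ 0
count-false zero    = refl
count-false (suc m) = count-false m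

count-mono : ∀ m {P Q : Fin m → Bool} → (∀ i → P i ≡ true → Q i ≡ true) → count m P ≤ count m Q
count-mono m {P} {Q} P⇒Q = begin
  count m P           ≡⟨ count≡∑𝟙 m P ⟩
  ∑[ i < m ] 𝟙 (P i)  ≤⟨ ∑-mono-≤ (λ i → 𝟙-mono (P⇒Q i)) ⟩
  ∑[ i < m ] 𝟙 (Q i)  ≡⟨ count≡∑𝟙 m Q ⟨
  count m Q           ∎
  where
  open ℕ.≤-Reasoning
  𝟙-mono : ∀ {a b} → (a ≡ true → b ≡ true) → 𝟙 a ≤ 𝟙 b
  𝟙-mono {false} _   = z≤n
  𝟙-mono {true}  a⇒b rewrite a⇒b refl = ℕ.≤-refl

count-∨ : ∀ m (P Q : Fin m → Bool) → count m (λ i → P i ∨ Q i) ≤ count m P + count m Q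
count-∨ m P Q = begin
  count m (λ i → P i ∨ Q i)              ≡⟨ count≡∑𝟙 m _ ⟩
  ∑[ i < m ] 𝟙 (P i ∨ Q i)               ≤⟨ ∑-mono-≤ (λ i → 𝟙-∨ (P i) (Q i)) ⟩
  ∑[ i < m ] (𝟙 (P i) + 𝟙 (Q i))         ≡⟨ ∑-distrib-+ (𝟙 ∘ P) (𝟙 ∘ Q) ⟩
  ∑[ i < m ] 𝟙 (P i) + ∑[ i < m ] 𝟙 (Q i) ≡⟨ cong₂ _+_ (count≡∑𝟙 m P) (count≡∑𝟙 m Q) ⟨
  count m P + count m Q                  ∎
  where
  open ℕ.≤-Reasoning
  𝟙-∨ : ∀ a b → 𝟙 (a ∨ b) ≤ 𝟙 a + 𝟙 b
  𝟙-∨ true  b = s≤s z≤n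
  𝟙-∨ false b = ℕ.≤-refl

count-∧ : ∀ m (P Q : Fin m → Bool) → count m P + count m Q ≤ m + count m (λ i → P i ∧ Q i)
count-∧ m P Q = begin
  count m P + count m Q                    ≡⟨ cong₂ _+_ (count≡∑𝟙 m P) (count≡∑𝟙 m Q) ⟩
  ∑[ i < m ] 𝟙 (P i) + ∑[ i < m ] 𝟙 (Q i)  ≡⟨ ∑-distrib-+ (𝟙 ∘ P) (𝟙 ∘ Q) ⟨
  ∑[ i < m ] (𝟙 (P i) + 𝟙 (Q i))           ≤⟨ ∑-mono-≤ (λ i → 𝟙-∧ (P i) (Q i)) ⟩
  ∑[ i < m ] (1 + 𝟙 (P∧Q i))               ≡⟨ ∑-distrib-+ (λ _ → 1) (𝟙 ∘ P∧Q) ⟩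
  ∑[ i < m ] 1 + ∑[ i < m ] 𝟙 (P∧Q i)      ≡⟨ cong₂ _+_ (∑-const m 1) (sym (count≡∑𝟙 m P∧Q)) ⟩
  m * 1 + count m P∧Q                      ≡⟨ cong (_+ count m P∧Q) (ℕ.*-identityʳ m) ⟩
  m + count m P∧Q                          ∎
  where
  open ℕ.≤-Reasoning
  P∧Q : Fin m → Bool
  P∧Q i = P i ∧ Q i
  𝟙-∧ : ∀ a b → 𝟙 a + 𝟙 b ≤ 1 + 𝟙 (a ∧ b)
  𝟙-∧ true  b     = ℕ.≤-refl
  𝟙-∧ false true  = ℕ.≤-refl
  𝟙-∧ false false = z≤n

count-∧-≥ : ∀ m (P Q : Fin m → Bool) → 2 * m ≤ 3 * count m P → 2 * m ≤ 3 * count m Q →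
            m ≤ 3 * count m (λ i → P i ∧ Q i)
count-∧-≥ m P Q P-large Q-large = ℕ.+-cancelˡ-≤ (3 * m) m (3 * x) (begin
  3 * m + m       ≡⟨ 3m+m≡2m+2m m ⟩
  2 * m + 2 * m   ≤⟨ ℕ.+-mono-≤ P-large Q-large ⟩
  3 * a + 3 * b   ≡⟨ ℕ.*-distribˡ-+ 3 a b ⟨
  3 * (a + b)     ≤⟨ ℕ.*-monoʳ-≤ 3 (count-∧ m P Q) ⟩
  3 * (m + x)     ≡⟨ ℕ.*-distribˡ-+ 3 m x ⟩
  3 * m + 3 * x   ∎)
  where
  open ℕ.≤-Reasoning
  a b x : ℕ
  a = count m P
  b = count m Q
  x = count m (λ i → P i ∧ Q i)
  3m+m≡2m+2m : ∀ m → 3 * m + m ≡ 2 * m + 2 * m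
  3m+m≡2m+2m = solve-∀

count-≟ : ∀ m (k : Fin m) → count m (λ i → does (i ≟ k)) ≡ 1
count-≟ (suc m) zero    = cong suc (count-false m)
count-≟ (suc m) (suc k) = count-≟ m k

count-∈ : ∀ {m} (xs : List (Fin m)) → count m (λ i → does (i ∈? xs)) ≤ length xs
count-∈ {m} []       = ℕ.≤-reflexive (count-false m)
count-∈ {m} (x ∷ xs) =
  ℕ.≤-trans (count-∨ m _ _) (ℕ.+-mono-≤ (ℕ.≤-reflexive (count-≟ m x)) (count-∈ xs))

∑-count-comm : ∀ m s (E : Fin m → Fin s → Bool) →
               ∑[ j < m ] count s (E j) ≡ ∑[ r < s ] count m (λ j → E j r)
∑-count-comm m s E = begin
  ∑[ j < m ] count s (E j)          ≡⟨ sum-cong-≗ (λ j → count≡∑𝟙 s (E j)) ⟩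
  ∑[ j < m ] ∑[ r < s ] 𝟙 (E j r)   ≡⟨ ∑-comm (λ j r → 𝟙 (E j r)) ⟩
  ∑[ r < s ] ∑[ j < m ] 𝟙 (E j r)   ≡⟨ sum-cong-≗ (λ r → count≡∑𝟙 m (λ j → E j r)) ⟨
  ∑[ r < s ] count m (λ j → E j r)  ∎
  where open ≡-Reasoning

double-count : ∀ {m s} c t .{{_ : NonZero s}} (E : Fin m → Fin s → Bool) →
               (∀ j → s ≤ c * count s (E j)) → (∀ r → count m (λ j → E j r) ≤ t) → m ≤ c * t
double-count {m} {s} c t E often sparse = ℕ.*-cancelʳ-≤ m (c * t) s (begin
  m * s                                 ≡⟨ ∑-const m s ⟨
  ∑[ j < m ] s                          ≤⟨ ∑-mono-≤ often ⟩
  ∑[ j < m ] (c * count s (E j))        ≡⟨ *-distribˡ-sum c (λ j → count s (E j)) ⟨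
  c * ∑[ j < m ] count s (E j)          ≡⟨ cong (c *_) (∑-count-comm m s E) ⟩
  c * ∑[ r < s ] count m (λ j → E j r)  ≤⟨ ℕ.*-monoʳ-≤ c (∑-mono-≤ sparse) ⟩
  c * ∑[ r < s ] t                      ≡⟨ cong (c *_) (∑-const s t) ⟩
  c * (s * t)                           ≡⟨ cong (c *_) (ℕ.*-comm s t) ⟩
  c * (t * s)                           ≡⟨ ℕ.*-assoc c t s ⟨
  c * t * s                             ∎)
  where open ℕ.≤-Reasoning

queries : ∀ {n} → Tree n → Instance n → List (Fin n)
queries (leaf _)    I = []
queries (query j k) I = j ∷ queries (k (profit I j) (weight I j)) I

length-queries : ∀ {n} (T : Tree n) (I : Instance n) → length (queries T I) ≡ cost T I
length-queries (leaf _)    I = refl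
length-queries (query j k) I = cong suc (length-queries (k (profit I j) (weight I j)) I)

run-cong : ∀ {n} (T : Tree n) {I J : Instance n} →
           (∀ {j} → j ∈ queries T I → profit I j ≡ profit J j) →
           (∀ {j} → j ∈ queries T I → weight I j ≡ weight J j) →
           run T I ≡ run T J
run-cong (leaf _)    _     _     = refl
run-cong (query j k) {I} {J} p-agree w-agree = begin
  run (k (profit I j) (weight I j)) I
    ≡⟨ run-cong (k _ _) (p-agree ∘ there) (w-agree ∘ there) ⟩
  run (k (profit I j) (weight I j)) J
    ≡⟨ cong₂ (λ p w → run (k p w) J) (p-agree (here refl)) (w-agree (here refl)) ⟩
  run (k (profit J j) (weight J j)) J
    ∎
  where open ≡-Reasoning

distinguishing⇒∈queries : ∀ {n} (T : Tree n) {I J : Instance n} {k} →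
  (∀ i → profit I i ≡ profit J i) → (∀ i → i ≢ k → weight I i ≡ weight J i) →
  run T I ≢ run T J → k ∈ queries T I
distinguishing⇒∈queries T {I} {J} {k} p-agree w-agree distinguishes with k ∈? queries T I
... | yes k∈ = k∈
... | no  k∉ = contradiction (run-cong T (λ {i} _ → p-agree i) w-agree′) distinguishes
  where
  w-agree′ : ∀ {i} → i ∈ queries T I → weight I i ≡ weight J i
  w-agree′ {i} i∈ = w-agree i (λ { refl → k∉ i∈ })

p≤p+q : ∀ p {q} → 0ℚ ≤ℚ q → p ≤ℚ p +ℚ q
p≤p+q p 0≤q = subst (_≤ℚ p +ℚ _) (ℚ.+-identityʳ p) (ℚ.+-monoʳ-≤ p 0≤q)

p≤q+p : ∀ p {q} → 0ℚ ≤ℚ q → p ≤ℚ q +ℚ p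
p≤q+p p {q} 0≤q = subst (p ≤ℚ_) (ℚ.+-comm p q) (p≤p+q p 0≤q)

p<p+q : ∀ p {q} → 0ℚ <ℚ q → p <ℚ p +ℚ q
p<p+q p 0<q = subst (_<ℚ p +ℚ _) (ℚ.+-identityʳ p) (ℚ.+-monoʳ-< p 0<q)

Σ-zero : ∀ n → Σ n (λ _ → 0ℚ) ≡ 0ℚ
Σ-zero zero    = refl
Σ-zero (suc n) = trans (ℚ.+-identityˡ _) (Σ-zero n)

Σ-≟ : ∀ n (k : Fin n) → Σ n (λ i → if does (i ≟ k) then 1ℚ else 0ℚ) ≡ 1ℚ
Σ-≟ (suc n) zero    = cong (1ℚ +ℚ_) (Σ-zero n)
Σ-≟ (suc n) (suc k) = trans (ℚ.+-identityˡ _) (Σ-≟ n k)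

*-distribˡ-Σ : ∀ n c (f : Fin n → ℚ) → c *ℚ Σ n f ≡ Σ n (λ i → c *ℚ f i)
*-distribˡ-Σ zero    c f = ℚ.*-zeroʳ c
*-distribˡ-Σ (suc n) c f =
  trans (ℚ.*-distribˡ-+ c (f zero) _) (cong (c *ℚ f zero +ℚ_) (*-distribˡ-Σ n c (f ∘ suc)))

Σ-mono-≤ : ∀ {n} {f g : Fin n → ℚ} → (∀ i → f i ≤ℚ g i) → Σ n f ≤ℚ Σ n g
Σ-mono-≤ {zero}  _   = ℚ.≤-refl
Σ-mono-≤ {suc n} f≤g = ℚ.+-mono-≤ (f≤g zero) (Σ-mono-≤ (f≤g ∘ suc))

Σ-nonNeg : ∀ {n} {f : Fin n → ℚ} → (∀ i → 0ℚ ≤ℚ f i) → 0ℚ ≤ℚ Σ n f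
Σ-nonNeg {n} {f} f≥0 = subst (_≤ℚ Σ n f) (Σ-zero n) (Σ-mono-≤ f≥0)

≤-Σ : ∀ {n} {f : Fin n → ℚ} → (∀ i → 0ℚ ≤ℚ f i) → ∀ k → f k ≤ℚ Σ n f
≤-Σ {f = f} f≥0 zero    = p≤p+q (f zero) (Σ-nonNeg (f≥0 ∘ suc))
≤-Σ         f≥0 (suc k) = ℚ.≤-trans (≤-Σ (f≥0 ∘ suc) k) (p≤q+p _ (f≥0 zero))

+-≤-Σ : ∀ {n} {f : Fin n → ℚ} → (∀ i → 0ℚ ≤ℚ f i) → ∀ {k l} → k ≢ l → f k +ℚ f l ≤ℚ Σ n f
+-≤-Σ         f≥0 {zero}  {zero}  0≢0 = contradiction refl 0≢0
+-≤-Σ {f = f} f≥0 {zero}  {suc l} _ = ℚ.+-monoʳ-≤ (f zero) (≤-Σ (f≥0 ∘ suc) l)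
+-≤-Σ {f = f} f≥0 {suc k} {zero}  _ =
  subst (_≤ℚ _) (ℚ.+-comm (f zero) (f (suc k))) (ℚ.+-monoʳ-≤ (f zero) (≤-Σ (f≥0 ∘ suc) k))
+-≤-Σ         f≥0 {suc k} {suc l} k≢l =
  ℚ.≤-trans (+-≤-Σ (f≥0 ∘ suc) (k≢l ∘ cong suc)) (p≤q+p _ (f≥0 zero))

mask-nonNeg : ∀ b {x} → 0ℚ ≤ℚ x → 0ℚ ≤ℚ (if b then x else 0ℚ)
mask-nonNeg true  0≤x = 0≤x
mask-nonNeg false _   = ℚ.≤-refl

mask-≤ : ∀ b {x} → 0ℚ ≤ℚ x → (if b then x else 0ℚ) ≤ℚ x
mask-≤ true  _   = ℚ.≤-refl
mask-≤ false 0≤x = 0≤x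

sumOn-≤-Σ : ∀ {n} (C : Subset n) {f : Fin n → ℚ} → (∀ i → 0ℚ ≤ℚ f i) → sumOn C f ≤ℚ Σ n f
sumOn-≤-Σ C f≥0 = Σ-mono-≤ (λ i → mask-≤ (C i) (f≥0 i))

sumOn-+-≤-Σ : ∀ {n} (C : Subset n) {f : Fin n → ℚ} → (∀ i → 0ℚ ≤ℚ f i) →
              ∀ {k} → C k ≡ false → sumOn C f +ℚ f k ≤ℚ Σ n f
sumOn-+-≤-Σ {suc n} C {f} f≥0 {zero} Ck rewrite Ck = begin
  0ℚ +ℚ rest +ℚ f zero  ≡⟨ cong (_+ℚ f zero) (ℚ.+-identityˡ rest) ⟩
  rest +ℚ f zero        ≡⟨ ℚ.+-comm rest (f zero) ⟩
  f zero +ℚ rest        ≤⟨ ℚ.+-monoʳ-≤ (f zero) (sumOn-≤-Σ (C ∘ suc) (f≥0 ∘ suc)) ⟩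
  f zero +ℚ Σ n (f ∘ suc) ∎
  where
  open ℚ.≤-Reasoning
  rest : ℚ
  rest = sumOn (C ∘ suc) (f ∘ suc)
sumOn-+-≤-Σ {suc n} C {f} f≥0 {suc k} Ck = begin
  first +ℚ rest +ℚ f (suc k)    ≡⟨ ℚ.+-assoc first rest (f (suc k)) ⟩
  first +ℚ (rest +ℚ f (suc k))  ≤⟨ ℚ.+-mono-≤ (mask-≤ (C zero) (f≥0 zero)) rest-bound ⟩
  f zero +ℚ Σ n (f ∘ suc)       ∎
  where
  open ℚ.≤-Reasoning
  first rest : ℚ
  first = if C zero then f zero else 0ℚ
  rest  = sumOn (C ∘ suc) (f ∘ suc)
  rest-bound : rest +ℚ f (suc k) ≤ℚ Σ n (f ∘ suc)
  rest-bound = sumOn-+-≤-Σ (C ∘ suc) (f≥0 ∘ suc) Ck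

+-≤-sumOn : ∀ {n} (C : Subset n) {f : Fin n → ℚ} → (∀ i → 0ℚ ≤ℚ f i) →
            ∀ {k l} → k ≢ l → C k ≡ true → C l ≡ true → f k +ℚ f l ≤ℚ sumOn C f
+-≤-sumOn C {f} f≥0 {k} {l} k≢l Ck Cl =
  subst₂ (λ x y → x +ℚ y ≤ℚ sumOn C f) (cong (mask k) Ck) (cong (mask l) Cl)
    (+-≤-Σ (λ i → mask-nonNeg (C i) (f≥0 i)) k≢l)
  where
  mask : Fin _ → Bool → ℚ
  mask i b = if b then f i else 0ℚ

optimal-∋ : ∀ {n} {I : Instance n} {C D : Subset n} {k} → Optimal I C → Feasible I D →
            Σ n (profit I) <ℚ value I D +ℚ profit I k → C k ≡ true
optimal-∋ {n} {I} {C} {D} {k} (_ , C-max) D-feasible gap with C k in Ck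
... | true  = refl
... | false = ⊥-elim (ℚ.<-irrefl refl (begin-strict
  Σ n (profit I)              <⟨ gap ⟩
  value I D +ℚ profit I k     ≤⟨ ℚ.+-monoˡ-≤ (profit I k) (C-max D D-feasible) ⟩
  value I C +ℚ profit I k     ≤⟨ sumOn-+-≤-Σ C (profit≥0 I) Ck ⟩
  Σ n (profit I)              ∎))
  where open ℚ.≤-Reasoning

feasible-∌ : ∀ {n} {I : Instance n} {C : Subset n} {k l} → Feasible I C → k ≢ l →
             K I <ℚ weight I k +ℚ weight I l → C k ≡ true → C l ≡ false
feasible-∌ {I = I} {C} {k} {l} C-feasible k≢l overweight Ck with C l in Cl
... | false = refl
... | true  = ⊥-elim (ℚ.<-irrefl refl (begin-strict
  K I                          <⟨ overweight ⟩
  weight I k +ℚ weight I l     ≤⟨ +-≤-sumOn C (weight≥0 I) k≢l Ck Cl ⟩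
  sumOn C (weight I)           ≤⟨ C-feasible ⟩
  K I                          ∎))
  where open ℚ.≤-Reasoning

third twoThirds : ℚ
third     = ℤ.+ 1 / 3
twoThirds = ℤ.+ 2 / 3

-- Item 0 gets profit 3⁻ᵐ and item i+1 gets 2·3⁻⁽ⁱ⁺¹⁾; these sum to 1 and 3⁻ᵐ is the smallest.
tiny : ℕ → ℚ
tiny zero    = 1ℚ
tiny (suc m) = third *ℚ tiny m

large : ∀ {m} → Fin m → ℚ
large zero    = twoThirds
large (suc i) = third *ℚ large i

tiny-pos : ∀ m → 0ℚ <ℚ tiny m
tiny-pos zero    = toWitness {a? = 0ℚ ℚ.<? 1ℚ} _
tiny-pos (suc m) =
  subst (_<ℚ third *ℚ tiny m) (ℚ.*-zeroʳ third) (ℚ.*-monoʳ-<-pos third (tiny-pos m))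

tiny≤third : ∀ m → tiny (suc m) ≤ℚ third
tiny≤third zero    = ℚ.≤-refl
tiny≤third (suc m) =
  ℚ.≤-trans (ℚ.*-monoˡ-≤-nonNeg third (tiny≤third m)) (toWitness {a? = third *ℚ third ℚ.≤? third} _)

tiny<large : ∀ {m} (i : Fin m) → tiny m <ℚ large i
tiny<large {suc m} zero    = ℚ.≤-<-trans (tiny≤third m) (toWitness {a? = third ℚ.<? twoThirds} _)
tiny<large {suc m} (suc i) = ℚ.*-monoʳ-<-pos third (tiny<large i)

tiny+Σlarge : ∀ m → tiny m +ℚ Σ m large ≡ 1ℚ
tiny+Σlarge zero    = refl
tiny+Σlarge (suc m) = begin
  third *ℚ tiny m +ℚ (twoThirds +ℚ Σ m (λ i → third *ℚ large i))
    ≡⟨ cong (λ s → third *ℚ tiny m +ℚ (twoThirds +ℚ s)) (*-distribˡ-Σ m third large) ⟨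
  third *ℚ tiny m +ℚ (twoThirds +ℚ third *ℚ Σ m large)
    ≡⟨ regroup (tiny m) (Σ m large) ⟩
  twoThirds +ℚ third *ℚ (tiny m +ℚ Σ m large)
    ≡⟨ cong (λ s → twoThirds +ℚ third *ℚ s) (tiny+Σlarge m) ⟩
  twoThirds +ℚ third *ℚ 1ℚ
    ≡⟨⟩
  1ℚ ∎
  where
  open ≡-Reasoning
  open +-*-Solver
  regroup : ∀ a s → third *ℚ a +ℚ (twoThirds +ℚ third *ℚ s) ≡ twoThirds +ℚ third *ℚ (a +ℚ s)
  regroup = solve 2 (λ a s → con third :* a :+ (con twoThirds :+ con third :* s)
                          := con twoThirds :+ con third :* (a :+ s)) refl

profits : ∀ m → Fin (suc m) → ℚ
profits m zero    = tiny m
profits m (suc i) = large i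

profits-nonNeg : ∀ m i → 0ℚ ≤ℚ profits m i
profits-nonNeg m zero    = ℚ.<⇒≤ (tiny-pos m)
profits-nonNeg m (suc i) = ℚ.<⇒≤ (ℚ.<-trans (tiny-pos m) (tiny<large i))

weights : ∀ {m} → (Fin m → Bool) → Fin (suc m) → ℚ
weights heavy zero    = 1ℚ
weights heavy (suc i) = if heavy i then 1ℚ else 0ℚ

0≤1 : 0ℚ ≤ℚ 1ℚ
0≤1 = toWitness {a? = 0ℚ ℚ.≤? 1ℚ} _

hard : ∀ m → (Fin m → Bool) → Instance (suc m)
hard m heavy = record
  { K        = 1ℚ
  ; profit   = profits m
  ; weight   = weights heavy
  ; K≥0      = 0≤1
  ; profit≥0 = profits-nonNeg m
  ; weight≥0 = λ { zero → 0≤1 ; (suc i) → mask-nonNeg (heavy i) 0≤1 }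
  ; weight≤K = λ { zero → ℚ.≤-refl ; (suc i) → mask-≤ (heavy i) 0≤1 }
  ; total    = tiny+Σlarge m
  }

hard₀ : ∀ m → Instance (suc m)
hard₀ m = hard m (λ _ → false)

hardAt : ∀ {m} → Fin m → Instance (suc m)
hardAt {m} j = hard m (λ i → does (i ≟ j))

hard₀-weights-agree : ∀ {m} (j : Fin m) k → k ≢ suc j →
                      weight (hard₀ m) k ≡ weight (hardAt j) k
hard₀-weights-agree j zero    _      = refl
hard₀-weights-agree j (suc i) si≢sj rewrite dec-false (i ≟ j) (si≢sj ∘ cong suc) = refl

-- Everything fits, so an optimum takes every item of positive profit.
hard₀-optimal-∋-zero : ∀ {m} (C : Subset (suc m)) → Optimal (hard₀ m) C → C zero ≡ true
hard₀-optimal-∋-zero {m} C C-optimal =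
  optimal-∋ {I = hard₀ m} {C} {λ _ → true} {zero} C-optimal full-feasible (p<p+q _ (tiny-pos m))
  where
  full-feasible : Feasible (hard₀ m) (λ _ → true)
  full-feasible = ℚ.≤-reflexive (cong (1ℚ +ℚ_) (Σ-zero m))

-- Dropping item 0 is feasible and loses only 3⁻ᵐ, less than item j+1 is worth, so an optimum
-- keeps item j+1, and then item 0 no longer fits.
hardAt-optimal-∌-zero : ∀ {m} (j : Fin m) (C : Subset (suc m)) → Optimal (hardAt j) C →
                        C zero ≡ false
hardAt-optimal-∌-zero {m} j C C-optimal@(C-feasible , _) =
  feasible-∌ {I = hardAt j} {C} {suc j} {zero} C-feasible (λ ()) overweight
    (optimal-∋ {I = hardAt j} {C} {rest} {suc j} C-optimal rest-feasible gap)
  where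
  rest : Subset (suc m)
  rest zero    = false
  rest (suc _) = true
  rest-feasible : Feasible (hardAt j) rest
  rest-feasible = ℚ.≤-reflexive (trans (ℚ.+-identityˡ _) (Σ-≟ m j))
  gap : tiny m +ℚ Σ m large <ℚ (0ℚ +ℚ Σ m large) +ℚ large j
  gap = begin-strict
    tiny m +ℚ Σ m large            <⟨ ℚ.+-monoˡ-< (Σ m large) (tiny<large j) ⟩
    large j +ℚ Σ m large           ≡⟨ ℚ.+-comm (large j) _ ⟩
    Σ m large +ℚ large j           ≡⟨ cong (_+ℚ large j) (ℚ.+-identityˡ (Σ m large)) ⟨
    (0ℚ +ℚ Σ m large) +ℚ large j   ∎
    where open ℚ.≤-Reasoning
  overweight : 1ℚ <ℚ weight (hardAt j) (suc j) +ℚ 1ℚ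
  overweight rewrite dec-true (j ≟ j) refl = toWitness {a? = 1ℚ ℚ.<? 1ℚ +ℚ 1ℚ} _

≟true∧≟false⇒≢ : ∀ a b → ⌊ a Bool.≟ true ⌋ ∧ ⌊ b Bool.≟ false ⌋ ≡ true → a ≢ b
≟true∧≟false⇒≢ true  false _ ()
≟true∧≟false⇒≢ true  true  ()
≟true∧≟false⇒≢ false _     ()

module _ {t : ℕ → ℕ} (A : OptimalLCA t) where
  open OptimalLCA A

  correct-when-forced : ∀ {n} (I : Instance n) i {s} → (∀ C → Optimal I C → C i ≡ s) →
    2 * seeds n ≤ 3 * count (seeds n) (λ r → ⌊ run (alg n r (K I) i) I Bool.≟ s ⌋)
  correct-when-forced {n} I i forced =
    ℕ.≤-trans (correct n I i) (ℕ.*-monoʳ-≤ 3 (count-mono (seeds n) answer-is-forced))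
    where
    answer-is-forced : ∀ r → ⌊ run (alg n r (K I) i) I Bool.≟ sol n I r i ⌋ ≡ true →
                             ⌊ run (alg n r (K I) i) I Bool.≟ _ ⌋ ≡ true
    answer-is-forced r = subst (λ s → ⌊ run (alg n r (K I) i) I Bool.≟ s ⌋ ≡ true)
                               (forced (sol n I r) (optimal n I r))

  queries-lower-bound : ∀ m → m ≤ 3 * t (suc m)
  queries-lower-bound m =
    double-count 3 (t (suc m)) {{ℕ.>-nonZero (seeds≥1 (suc m))}} queried often sparse
    where
    tree : Fin (seeds (suc m)) → Tree (suc m)
    tree r = alg (suc m) r 1ℚ zero
    queried : Fin m → Fin (seeds (suc m)) → Bool
    queried j r = does (suc j ∈? queries (tree r) (hard₀ m))
    sparse : ∀ r → count m (λ j → queried j r) ≤ t (suc m)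
    sparse r = begin
      count m (λ j → queried j r)            ≤⟨ ℕ.m≤n+m _ _ ⟩
      count (suc m) (λ k → does (k ∈? qs))   ≤⟨ count-∈ qs ⟩
      length qs                              ≡⟨ length-queries (tree r) (hard₀ m) ⟩
      cost (tree r) (hard₀ m)                ≤⟨ time (suc m) (hard₀ m) r zero ⟩
      t (suc m)                              ∎
      where
      open ℕ.≤-Reasoning
      qs : List (Fin (suc m))
      qs = queries (tree r) (hard₀ m)
    often : ∀ j → seeds (suc m) ≤ 3 * count (seeds (suc m)) (queried j)
    often j = ℕ.≤-trans (count-∧-≥ _ _ _ accepts rejects) (ℕ.*-monoʳ-≤ 3 (count-mono _ distinguished))
      where
      accepts : 2 * seeds (suc m) ≤ 3 * count _ (λ r → ⌊ run (tree r) (hard₀ m) Bool.≟ true ⌋)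
      accepts = correct-when-forced (hard₀ m) zero hard₀-optimal-∋-zero
      rejects : 2 * seeds (suc m) ≤ 3 * count _ (λ r → ⌊ run (tree r) (hardAt j) Bool.≟ false ⌋)
      rejects = correct-when-forced (hardAt j) zero (hardAt-optimal-∌-zero j)
      distinguished : ∀ r → ⌊ run (tree r) (hard₀ m) Bool.≟ true ⌋ ∧
                            ⌊ run (tree r) (hardAt j) Bool.≟ false ⌋ ≡ true →
                      queried j r ≡ true
      distinguished r both = dec-true (suc j ∈? _)
        (distinguishing⇒∈queries (tree r) (λ _ → refl) (hard₀-weights-agree j) (≟true∧≟false⇒≢ _ _ both))

1+m≤3t⇒2+m≤4t : ∀ {m} t → suc m ≤ 3 * t → suc (suc m) ≤ 4 * t
1+m≤3t⇒2+m≤4t (suc t) 1+m≤3t = ℕ.≤-trans (s≤s 1+m≤3t) (s≤s (ℕ.m≤n+m _ t))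

theorem3p2 : (t : ℕ → ℕ) → OptimalLCA t →
    Σ[ c ∈ ℕ ] Σ[ n₀ ∈ ℕ ] (∀ n → n₀ ≤ n → n ≤ c * t n)
theorem3p2 t A = 4 , 2 , linear
  where
  linear : ∀ n → 2 ≤ n → n ≤ 4 * t n
  linear (suc (suc m)) (s≤s (s≤s z≤n)) =
    1+m≤3t⇒2+m≤4t (t (suc (suc m))) (queries-lower-bound A (suc m))
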